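{- Let $m\ge 1$. The set of permutations $\pi\in S_{2m+1}$ with $\pi_i\le m+i$ for $1\le i\le m$ and $\pi_i\ge i-m$ for $m+1\le i\le 2m+1$ is in bijection with the set of permutations in $S_{2m+1}$ whose excedance set is exactly $\{1,\dots,m\}$. The set of permutations $\pi\in S_{2m}$ with $\pi_i\le m+i$ for $1\le i\le m$ and $\pi_i\ge i-m+1$ for $m+1\le i\le 2m$ is in bijection with the set of permutations in $S_{2m}$ whose excedance set is exactly $\{1,\dots,m-1\}$.
   Context: An excedance of $\sigma\in S_n$ is an index $i$ with $\sigma_i>i$; the excedance set of $\sigma$ is the set of its excedances. -}

module Defs where

open import Data.Nat using (ℕ; suc; _+_; _*_; _≤_; _<_)
open import Data.Fin using (Fin; toℕ)
open import Data.Vec using (Vec; lookup)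
open import Relation.Binary.PropositionalEquality using (_≡_)
open import Function.Bundles using (_⇔_)

-- A permutation of [n] in one-line notation, with positions/values 0-based:
-- position k (0-based) corresponds to index i = k+1, and value v to π_i = v+1.
-- Injectivity (hence bijectivity on Fin n) is an irrelevant field, so two
-- permutations are equal iff their one-line vectors are equal.
record Perm (n : ℕ) : Set where
  constructor mkPerm
  field
    oneLine : Vec (Fin n) n
    .injective : ∀ (j k : Fin n) → lookup oneLine j ≡ lookup oneLine k → j ≡ k

open Perm public

val : ∀ {n} → Perm n → Fin n → ℕ
val π k = toℕ (lookup (oneLine π) k)

Excedance : ∀ {n} → Perm n → Fin n → Set
Excedance π k = toℕ k < val π k

-- excedance set (1-based) is exactly {1,…,e}: position k is an excedance iff k < e
ExcSetIsInitial : ∀ {n} → ℕ → Perm n → Set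
ExcSetIsInitial e π = ∀ k → Excedance π k ⇔ toℕ k < e

-- odd case, n = 2m+1 : π_i ≤ m+i for 1≤i≤m,  π_i ≥ i-m for m+1≤i≤2m+1
OddBounded : (m : ℕ) → Perm (suc (2 * m)) → Set
OddBounded m π =
  (∀ k → toℕ k < m → val π k ≤ m + toℕ k) ×'
  (∀ k → m ≤ toℕ k → toℕ k ≤ val π k + m)
  where
    open import Data.Product using () renaming (_×_ to _×'_)

-- even case, n = 2m : π_i ≤ m+i for 1≤i≤m,  π_i ≥ i-m+1 for m+1≤i≤2m
EvenBounded : (m : ℕ) → Perm (2 * m) → Set
EvenBounded m π =
  (∀ k → toℕ k < m → val π k ≤ m + toℕ k) ×'
  (∀ k → m ≤ toℕ k → suc (toℕ k) ≤ val π k + m)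
  where
    open import Data.Product using () renaming (_×_ to _×'_)

-- the set { π ∈ S_n | P π }; membership proof is irrelevant, so elements are
-- equal iff the underlying permutations are equal (a genuine subset).
record PermsWith (n : ℕ) (P : Perm n → Set) : Set where
  constructor _,_
  field
    perm : Perm n
    .holds : P perm

module Submission where

-- Both bijections are restrictions of explicit bijections of S_n. If n = a + b, shifting
-- positions cyclically by b maps the permutations with π(j) ≤ a + j for j < b and
-- π(j) > j − b for j ≥ b onto those with excedance set [0, a); the odd case is a = m,
-- b = m + 1. In the even case the conditions are those with a = b = m, and the
-- reverse-complement π ↦ (n−1) − π((n−1) − ·) first turns them into a = m − 1, b = m + 1.

open import Defs
open import Data.Nat using (ℕ; suc; _+_; _*_; _∸_; _≤_; _<_; _<?_; s≤s; s≤s⁻¹)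
open import Data.Nat.Properties
open import Data.Fin using (Fin; toℕ; fromℕ<; opposite)
open import Data.Fin.Properties using (toℕ-fromℕ<; toℕ<n; toℕ-injective; opposite-prop; opposite-involutive)
open import Data.Vec using (lookup; tabulate)
open import Data.Vec.Properties using (lookup∘tabulate; tabulate∘lookup; tabulate-cong)
open import Data.Product using (_×_; _,_)
open import Relation.Nullary using (Dec; yes; no)
open import Relation.Nullary.Negation using (contradiction)
open import Relation.Binary.PropositionalEquality
open import Function.Base using (_∘_; const)
open import Function.Bundles using (_⤖_; _↔_; _⇔_; Inverse; Bijection; mk↔ₛ′; mk⇔; module Equivalence)
open import Function.Properties.Inverse using (↔-refl; ↔-sym; ↔-trans; ↔⇒⤖)

open Inverse using (to; from; strictlyInverseˡ; strictlyInverseʳ)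

Perm-≡ : ∀ {n} {π σ : Perm n} → oneLine π ≡ oneLine σ → π ≡ σ
Perm-≡ {π = mkPerm _ _} {mkPerm _ _} refl = refl

PermsWith-≡ : ∀ {n P} {x y : PermsWith n P} → PermsWith.perm x ≡ PermsWith.perm y → x ≡ y
PermsWith-≡ {x = _ , _} {_ , _} refl = refl

PermsWith-cong : ∀ {n} {P Q : Perm n → Set} (e : Perm n ↔ Perm n) →
                 (∀ π → P π → Q (to e π)) → (∀ σ → Q σ → P (from e σ)) →
                 PermsWith n P ↔ PermsWith n Q
PermsWith-cong e P⇒Q Q⇒P = mk↔ₛ′
  (λ (π , p) → to e π , P⇒Q π p)
  (λ (σ , q) → from e σ , Q⇒P σ q)
  (λ (σ , _) → PermsWith-≡ (strictlyInverseˡ e σ))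
  (λ (π , _) → PermsWith-≡ (strictlyInverseʳ e π))

relabel : ∀ {n} (ρ τ : Fin n ↔ Fin n) → Perm n → Perm n
relabel ρ τ (mkPerm π π-injective) = mkPerm (tabulate f) λ j k eq →
  injective′ ρ (π-injective _ _ (injective′ τ (trans (sym (lookup∘tabulate f j)) (trans eq (lookup∘tabulate f k)))))
  where
    f = to τ ∘ lookup π ∘ to ρ
    injective′ = Bijection.injective ∘ ↔⇒⤖

lookup-relabel : ∀ {n} (ρ τ : Fin n ↔ Fin n) π k →
                 lookup (oneLine (relabel ρ τ π)) k ≡ to τ (lookup (oneLine π) (to ρ k))
lookup-relabel ρ τ (mkPerm _ _) = lookup∘tabulate _

relabel-inverse : ∀ {n} (ρ τ : Fin n ↔ Fin n) π → relabel (↔-sym ρ) (↔-sym τ) (relabel ρ τ π) ≡ π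
relabel-inverse ρ τ π = Perm-≡ (begin
  tabulate (from τ ∘ lookup (oneLine (relabel ρ τ π)) ∘ from ρ)
    ≡⟨ tabulate-cong (λ k → cong (from τ) (lookup-relabel ρ τ π (from ρ k))) ⟩
  tabulate (λ k → from τ (to τ (lookup (oneLine π) (to ρ (from ρ k)))))
    ≡⟨ tabulate-cong (λ k → trans (strictlyInverseʳ τ _) (cong (lookup (oneLine π)) (strictlyInverseˡ ρ k))) ⟩
  tabulate (lookup (oneLine π))
    ≡⟨ tabulate∘lookup (oneLine π) ⟩
  oneLine π ∎)
  where open ≡-Reasoning

relabel-↔ : ∀ {n} (ρ τ : Fin n ↔ Fin n) → Perm n ↔ Perm n
relabel-↔ ρ τ = mk↔ₛ′ (relabel ρ τ) (relabel (↔-sym ρ) (↔-sym τ))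
  (relabel-inverse (↔-sym ρ) (↔-sym τ)) (relabel-inverse ρ τ)

-- the cyclic shift k ↦ k + b (mod a + b)
rotate : ∀ {n} a b → .(a + b ≡ n) → Fin n → Fin n
rotate a b a+b≡n k with toℕ k <? a
... | yes k<a = fromℕ< (subst (b + toℕ k <_) (trans (+-comm b a) a+b≡n) (+-monoʳ-< b k<a))
... | no _    = fromℕ< (≤-<-trans (m∸n≤m (toℕ k) a) (toℕ<n k))

module _ {n} (a b : ℕ) (a+b≡n : a + b ≡ n) (k : Fin n) where

  toℕ-rotate-< : toℕ k < a → toℕ (rotate a b a+b≡n k) ≡ b + toℕ k
  toℕ-rotate-< k<a with toℕ k <? a
  ... | yes _   = toℕ-fromℕ< _
  ... | no k≮a = contradiction k<a k≮a

  toℕ-rotate-≥ : a ≤ toℕ k → a + toℕ (rotate a b a+b≡n k) ≡ toℕ k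
  toℕ-rotate-≥ a≤k with toℕ k <? a
  ... | yes k<a = contradiction a≤k (<⇒≱ k<a)
  ... | no _    = trans (cong (a +_) (toℕ-fromℕ< _)) (m+[n∸m]≡n a≤k)

  toℕ-rotate-<b : a ≤ toℕ k → toℕ (rotate a b a+b≡n k) < b
  toℕ-rotate-<b a≤k = +-cancelˡ-< a _ b (subst (_< a + b) (sym (toℕ-rotate-≥ a≤k)) (subst (toℕ k <_) (sym a+b≡n) (toℕ<n k)))

rotate-inverse : ∀ {n} a b (a+b≡n : a + b ≡ n) (b+a≡n : b + a ≡ n) k →
                 rotate b a b+a≡n (rotate a b a+b≡n k) ≡ k
rotate-inverse a b a+b≡n b+a≡n k = toℕ-injective (by-cases (toℕ k <? a))
  where
    open ≡-Reasoning
    r : Fin _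
    r = rotate a b a+b≡n k
    by-cases : Dec (toℕ k < a) → toℕ (rotate b a b+a≡n r) ≡ toℕ k
    by-cases (yes k<a) = +-cancelˡ-≡ b _ _ (begin
      b + toℕ (rotate b a _ r) ≡⟨ toℕ-rotate-≥ b a b+a≡n r (subst (b ≤_) (sym r≡b+k) (m≤m+n b (toℕ k))) ⟩
      toℕ r                    ≡⟨ r≡b+k ⟩
      b + toℕ k                ∎)
      where
        r≡b+k : toℕ r ≡ b + toℕ k
        r≡b+k = toℕ-rotate-< a b a+b≡n k k<a
    by-cases (no k≮a) = begin
      toℕ (rotate b a _ r) ≡⟨ toℕ-rotate-< b a b+a≡n r (toℕ-rotate-<b a b a+b≡n k (≮⇒≥ k≮a)) ⟩
      a + toℕ r            ≡⟨ toℕ-rotate-≥ a b a+b≡n k (≮⇒≥ k≮a) ⟩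
      toℕ k                ∎

rotate-↔ : ∀ {n} a b → a + b ≡ n → Fin n ↔ Fin n
rotate-↔ {n} a b a+b≡n = mk↔ₛ′ (rotate a b a+b≡n) (rotate b a b+a≡n)
  (rotate-inverse b a b+a≡n a+b≡n) (rotate-inverse a b a+b≡n b+a≡n)
  where
    b+a≡n : b + a ≡ n
    b+a≡n = trans (+-comm b a) a+b≡n

-- EvenBounded m is definitionally ShiftBounded m m.
ShiftBounded : ∀ {n} → ℕ → ℕ → Perm n → Set
ShiftBounded a b π = (∀ j → toℕ j < b → val π j ≤ a + toℕ j) × (∀ j → b ≤ toℕ j → toℕ j < val π j + b)

val-relabel-positions : ∀ {n} (ρ : Fin n ↔ Fin n) π k → val (relabel ρ ↔-refl π) k ≡ val π (to ρ k)
val-relabel-positions ρ π k = cong toℕ (lookup-relabel ρ ↔-refl π k)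

module _ {n} (a b : ℕ) (a+b≡n : a + b ≡ n) where

  private
    b+a≡n : b + a ≡ n
    b+a≡n = trans (+-comm b a) a+b≡n

  ShiftBounded⇒ExcSetIsInitial : ∀ π → ShiftBounded a b π →
                                 ExcSetIsInitial a (relabel (rotate-↔ a b a+b≡n) ↔-refl π)
  ShiftBounded⇒ExcSetIsInitial π (below , above) k = by-cases (toℕ k <? a)
    where
      r : Fin n
      r = rotate a b a+b≡n k
      v≡ : val (relabel (rotate-↔ a b a+b≡n) ↔-refl π) k ≡ val π r
      v≡ = val-relabel-positions (rotate-↔ a b a+b≡n) π k
      by-cases : Dec (toℕ k < a) → Excedance (relabel (rotate-↔ a b a+b≡n) ↔-refl π) k ⇔ toℕ k < a
      by-cases (yes k<a) = mk⇔ (const k<a) (const (subst (toℕ k <_) (sym v≡) k<v))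
        where
          r≡b+k : toℕ r ≡ b + toℕ k
          r≡b+k = toℕ-rotate-< a b a+b≡n k k<a
          k<v : toℕ k < val π r
          k<v = +-cancelʳ-< b _ _ (subst (_< val π r + b) (trans r≡b+k (+-comm b (toℕ k)))
                  (above r (subst (b ≤_) (sym r≡b+k) (m≤m+n b (toℕ k)))))
      by-cases (no k≮a) = mk⇔ (λ k<v → contradiction (subst (toℕ k <_) v≡ k<v) (≤⇒≯ v≤k)) (λ k<a → contradiction k<a k≮a)
        where
          v≤k : val π r ≤ toℕ k
          v≤k = subst (val π r ≤_) (toℕ-rotate-≥ a b a+b≡n k (≮⇒≥ k≮a)) (below r (toℕ-rotate-<b a b a+b≡n k (≮⇒≥ k≮a)))

  ExcSetIsInitial⇒ShiftBounded : ∀ σ → ExcSetIsInitial a σ →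
                                 ShiftBounded a b (relabel (rotate-↔ b a b+a≡n) ↔-refl σ)
  ExcSetIsInitial⇒ShiftBounded σ exc = below , above
    where
      r : Fin n → Fin n
      r = rotate b a b+a≡n
      v≡ : ∀ j → val (relabel (rotate-↔ b a b+a≡n) ↔-refl σ) j ≡ val σ (r j)
      v≡ = val-relabel-positions (rotate-↔ b a b+a≡n) σ

      below : ∀ j → toℕ j < b → val (relabel (rotate-↔ b a b+a≡n) ↔-refl σ) j ≤ a + toℕ j
      below j j<b = subst₂ _≤_ (sym (v≡ j)) r≡a+j (≮⇒≥ λ r<v → <⇒≱ (Equivalence.to (exc (r j)) r<v) a≤r)
        where
          r≡a+j : toℕ (r j) ≡ a + toℕ j
          r≡a+j = toℕ-rotate-< b a b+a≡n j j<b
          a≤r : a ≤ toℕ (r j)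
          a≤r = subst (a ≤_) (sym r≡a+j) (m≤m+n a (toℕ j))

      above : ∀ j → b ≤ toℕ j → toℕ j < val (relabel (rotate-↔ b a b+a≡n) ↔-refl σ) j + b
      above j b≤j = subst₂ _<_ (toℕ-rotate-≥ b a b+a≡n j b≤j) (trans (+-comm b _) (cong (_+ b) (sym (v≡ j))))
                      (+-monoʳ-< b (Equivalence.from (exc (r j)) (toℕ-rotate-<b b a b+a≡n j b≤j)))

  ShiftBounded↔ExcSetIsInitial : PermsWith n (ShiftBounded a b) ↔ PermsWith n (ExcSetIsInitial a)
  ShiftBounded↔ExcSetIsInitial = PermsWith-cong (relabel-↔ (rotate-↔ a b a+b≡n) ↔-refl)
    ShiftBounded⇒ExcSetIsInitial ExcSetIsInitial⇒ShiftBounded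

opposite-↔ : ∀ {n} → Fin n ↔ Fin n
opposite-↔ = mk↔ₛ′ opposite opposite opposite-involutive opposite-involutive

toℕ-opposite-+ : ∀ {n} (i : Fin n) → suc (toℕ (opposite i) + toℕ i) ≡ n
toℕ-opposite-+ {n} i = begin
  suc (toℕ (opposite i) + toℕ i) ≡⟨ sym (+-suc (toℕ (opposite i)) (toℕ i)) ⟩
  toℕ (opposite i) + suc (toℕ i) ≡⟨ cong (_+ suc (toℕ i)) (opposite-prop i) ⟩
  n ∸ suc (toℕ i) + suc (toℕ i)  ≡⟨ m∸n+n≡m (toℕ<n i) ⟩
  n                              ∎
  where open ≡-Reasoning

complement-≤ : ∀ {p p′ q q′} c → p + p′ ≡ q + q′ → p ≤ c + q′ → q ≤ c + p′
complement-≤ {p} {p′} {q} {q′} c sums p≤c+q′ = +-cancelˡ-≤ q′ q (c + p′) (begin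
  q′ + q       ≡⟨ +-comm q′ q ⟩
  q + q′       ≡⟨ sym sums ⟩
  p + p′       ≤⟨ +-monoˡ-≤ p′ p≤c+q′ ⟩
  c + q′ + p′  ≡⟨ cong (_+ p′) (+-comm c q′) ⟩
  q′ + c + p′  ≡⟨ +-assoc q′ c p′ ⟩
  q′ + (c + p′) ∎)
  where open ≤-Reasoning

ShiftBounded-reverse : ∀ {n} a b → suc (a + b) ≡ n → ∀ π → ShiftBounded a (suc b) π →
                       ShiftBounded b (suc a) (relabel opposite-↔ opposite-↔ π)
ShiftBounded-reverse a b 1+a+b≡n π (below , above) = below′ , above′
  where
    σ : Perm _
    σ = relabel opposite-↔ opposite-↔ π

    positions : ∀ i → toℕ (opposite i) + toℕ i ≡ a + b
    positions i = suc-injective (trans (toℕ-opposite-+ i) (sym 1+a+b≡n))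

    values : ∀ k → val σ k + val π (opposite k) ≡ a + b
    values k = trans (cong (λ x → toℕ x + val π (opposite k)) (lookup-relabel opposite-↔ opposite-↔ π k))
                     (positions (lookup (oneLine π) (opposite k)))

    below′ : ∀ k → toℕ k < suc a → val σ k ≤ b + toℕ k
    below′ k _ with toℕ k <? a
    ... | yes k<a = complement-≤ b (trans (positions k) (sym (values k))) k′≤b+v
      where
        1+b≤k′ : suc b ≤ toℕ (opposite k)
        1+b≤k′ = complement-≤ 0 (cong suc (trans (+-comm (toℕ k) _) (trans (positions k) (+-comm a b)))) k<a
        k′≤b+v : toℕ (opposite k) ≤ b + val π (opposite k)
        k′≤b+v = s≤s⁻¹ (subst (suc (toℕ (opposite k)) ≤_) (trans (+-suc _ b) (cong suc (+-comm _ b)))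
                                (above (opposite k) 1+b≤k′))
    ... | no k≮a = begin
      val σ k  ≤⟨ m≤m+n (val σ k) _ ⟩
      val σ k + val π (opposite k) ≡⟨ values k ⟩
      a + b    ≡⟨ +-comm a b ⟩
      b + a    ≤⟨ +-monoʳ-≤ b (≮⇒≥ k≮a) ⟩
      b + toℕ k ∎
      where open ≤-Reasoning

    above′ : ∀ k → suc a ≤ toℕ k → toℕ k < val σ k + suc a
    above′ k 1+a≤k = subst (suc (toℕ k) ≤_) (trans (cong suc (+-comm a _)) (sym (+-suc _ a))) (s≤s k≤a+s)
      where
        k′<1+b : toℕ (opposite k) < suc b
        k′<1+b = s≤s (complement-≤ 0 (sym (positions k)) (<⇒≤ 1+a≤k))
        k≤a+s : toℕ k ≤ a + val σ k
        k≤a+s = complement-≤ a (trans (+-comm _ (val σ k)) (trans (values k) (trans (sym (positions k)) (+-comm _ (toℕ k)))))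
                               (below (opposite k) k′<1+b)

2*m≡m+m : ∀ m → 2 * m ≡ m + m
2*m≡m+m m = cong (m +_) (+-identityʳ m)

module _ (m : ℕ) where

  OddBounded⇒ShiftBounded : ∀ π → OddBounded m π → ShiftBounded m (suc m) π
  OddBounded⇒ShiftBounded π (below , above) = below′ , λ j 1+m≤j →
    subst (toℕ j <_) (sym (+-suc (val π j) m)) (s≤s (above j (<⇒≤ 1+m≤j)))
    where
      below′ : ∀ j → toℕ j < suc m → val π j ≤ m + toℕ j
      below′ j _ with toℕ j <? m
      ... | yes j<m = below j j<m
      ... | no j≮m = begin
        val π j   ≤⟨ s≤s⁻¹ (toℕ<n (lookup (oneLine π) j)) ⟩
        2 * m     ≡⟨ 2*m≡m+m m ⟩
        m + m     ≤⟨ +-monoʳ-≤ m (≮⇒≥ j≮m) ⟩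
        m + toℕ j ∎
        where open ≤-Reasoning

  ShiftBounded⇒OddBounded : ∀ π → ShiftBounded m (suc m) π → OddBounded m π
  ShiftBounded⇒OddBounded π (below , above) = (λ j j<m → below j (m<n⇒m<1+n j<m)) , above′
    where
      above′ : ∀ j → m ≤ toℕ j → toℕ j ≤ val π j + m
      above′ j m≤j with m <? toℕ j
      ... | yes m<j = s≤s⁻¹ (subst (toℕ j <_) (+-suc (val π j) m) (above j m<j))
      ... | no m≮j = ≤-trans (≮⇒≥ m≮j) (m≤n+m m (val π j))

lemma3p5 : (m : ℕ) → 1 ≤ m →
    (PermsWith (suc (2 * m)) (OddBounded m) ⤖ PermsWith (suc (2 * m)) (ExcSetIsInitial m))
    × (PermsWith (2 * m) (EvenBounded m) ⤖ PermsWith (2 * m) (ExcSetIsInitial (m ∸ 1)))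
lemma3p5 m@(suc m′) _ = ↔⇒⤖ odd , ↔⇒⤖ even
  where
    1+m′+m≡2m : suc (m′ + m) ≡ 2 * m
    1+m′+m≡2m = sym (2*m≡m+m m)

    odd : PermsWith (suc (2 * m)) (OddBounded m) ↔ PermsWith (suc (2 * m)) (ExcSetIsInitial m)
    odd = ↔-trans (PermsWith-cong ↔-refl (OddBounded⇒ShiftBounded m) (ShiftBounded⇒OddBounded m))
                  (ShiftBounded↔ExcSetIsInitial m (suc m) (trans (+-suc m m) (cong suc (sym (2*m≡m+m m)))))
    even : PermsWith (2 * m) (EvenBounded m) ↔ PermsWith (2 * m) (ExcSetIsInitial m′)
    even = ↔-trans (PermsWith-cong (relabel-↔ opposite-↔ opposite-↔)
                                   (ShiftBounded-reverse m m′ (trans (cong suc (+-comm m m′)) 1+m′+m≡2m))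
                                   (ShiftBounded-reverse m′ m 1+m′+m≡2m))
                   (ShiftBounded↔ExcSetIsInitial m′ (suc m) (trans (+-suc m′ m) 1+m′+m≡2m))
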